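{- Let $G$ be a graph of order $n(G)\geq 3$ and maximum degree at most $3$. If $S$ is a set of vertices of $G$ such that $w_{(G,S)}(u)\geq 3$ for every $u\in V(G)\setminus S$, then $|S|\geq \frac{1}{4}(n(G)+6)$.
   Context: All graphs are finite, simple and undirected. For a graph $G$ and $S\subseteq V(G)$, and vertices $u,v$ with $u\in S$ or $v\in S$, let $\mathrm{dist}_{(G,S)}(u,v)$ be the minimum number of edges of a path $P$ in $G$ between $u$ and $v$ such that $S$ contains exactly one endvertex of $P$ and no internal vertex of $P$ (and $\infty$ if no such path exists; in particular $\mathrm{dist}_{(G,S)}(u,u)=0$ for $u\in S$). For a vertex $u$, let $w_{(G,S)}(u)=\sum_{v\in S}\left(\frac{1}{2}\right)^{\mathrm{dist}_{(G,S)}(u,v)-1}$ with $(1/2)^\infty=0$. -}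

module Defs where

open import Data.Nat as ℕ using (ℕ; zero; suc)
open import Data.Bool using (Bool; true; false; if_then_else_; T)
open import Data.Fin using (Fin)
open import Data.Fin.Subset using (Subset; _∈_; _∉_; inside; outside)
open import Data.List using (List; []; _∷_; _++_; [_]; length; map; allFin; foldr)
open import Data.List.Relation.Unary.All using (All)
open import Data.List.Relation.Unary.Linked using (Linked)
open import Data.List.Relation.Unary.Unique.Propositional using (Unique)
open import Data.Maybe using (Maybe; just; nothing)
open import Data.Product using (Σ; _×_; ∃)
open import Data.Sum using (_⊎_)
open import Data.Vec using (lookup)
open import Data.Rational using (ℚ; 0ℚ; 1ℚ; ½; _+_; _*_)
open import Relation.Binary.PropositionalEquality using (_≡_)
open import Relation.Nullary using (¬_)

record Graph (n : ℕ) : Set where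
  field
    adj     : Fin n → Fin n → Bool
    symm    : ∀ u v → adj u v ≡ adj v u
    irrefl  : ∀ u → adj u u ≡ false

open Graph public

Adj : ∀ {n} → Graph n → Fin n → Fin n → Set
Adj G u v = T (adj G u v)

degree : ∀ {n} → Graph n → Fin n → ℕ
degree {n} G u = foldr ℕ._+_ 0 (map (λ v → if adj G u v then 1 else 0) (allFin n))

-- The trivial path (ℓ = 0) is allowed only from a vertex of S to itself,
-- encoding the convention dist_(G,S)(u,u) = 0 for u ∈ S.
data SPath {n : ℕ} (G : Graph n) (S : Subset n) : Fin n → Fin n → ℕ → Set where
  trivial : ∀ {u} → u ∈ S → SPath G S u u 0
  nontrivial : ∀ {u v} (mid : List (Fin n)) →
    Unique (u ∷ mid ++ [ v ]) →
    Linked (Adj G) (u ∷ mid ++ [ v ]) →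
    ((u ∈ S × v ∉ S) ⊎ (u ∉ S × v ∈ S)) →
    All (λ x → x ∉ S) mid →
    SPath G S u v (suc (length mid))

-- d is dist_(G,S)(u,v); nothing stands for ∞.
IsDist : ∀ {n} → Graph n → Subset n → Fin n → Fin n → Maybe ℕ → Set
IsDist G S u v (just d)  = SPath G S u v d × (∀ ℓ → SPath G S u v ℓ → d ℕ.≤ ℓ)
IsDist G S u v nothing   = ∀ ℓ → ¬ SPath G S u v ℓ

halfPow : ℕ → ℚ
halfPow zero    = 1ℚ
halfPow (suc k) = ½ * halfPow k

-- (1/2)^(d - 1), with (1/2)^∞ = 0 and (1/2)^(0-1) = 2.
term : Maybe ℕ → ℚ
term nothing        = 0ℚ
term (just zero)    = 1ℚ + 1ℚ
term (just (suc k)) = halfPow k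

weightOf : ∀ {n} → Subset n → (Fin n → Maybe ℕ) → ℚ
weightOf {n} S δ =
  foldr _+_ 0ℚ (map (λ v → if lookup S v then term (δ v) else 0ℚ) (allFin n))

IsWeight : ∀ {n} → Graph n → Subset n → Fin n → ℚ → Set
IsWeight {n} G S u w =
  Σ (Fin n → Maybe ℕ) λ δ → (∀ v → v ∈ S → IsDist G S u v (δ v)) × (w ≡ weightOf S δ)

module Submission where

-- Fix u ∉ S and search H = V(G) ∖ S breadth-first from u. Every vertex first met in round j + 1, in H
-- or in S, is adjacent to one met in round j; u has at most 3 edges and every later vertex of H at
-- most 2 besides the one to its predecessor. As a vertex of S met in round j + 1 contributes 2^-j to
-- w(u), this budget caps w(u) at 3, and w(u) ≥ 3 forces it to be spent exactly: the search stops
-- inside H, having exhausted the component C of u in G[H], and has met at least |C| + 2 vertices of S,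
-- each adjacent to C. So each component of G[H] has at least |C| + 2 neighbours in S and sends at
-- least |C| + 2 edges to S. With at most two components this gives |H| + 6 ≤ 3|S| directly; with three
-- or more, |H| + 6 ≤ e(H, S) ≤ 3|S|. As |H| + |S| = n, this is n + 6 ≤ 4|S|.

open import Defs using (Graph; adj; symm; Adj; degree; SPath; trivial; nontrivial; IsDist; IsWeight; halfPow; term; weightOf)

import Data.Nat.Properties as ℕₚ
import Data.Rational.Properties as ℚₚ

open import Algebra.Bundles using (CommutativeRing)
open import Algebra.Properties.CommutativeMonoid.Sum ℕₚ.+-0-commutativeMonoid
  using (sum; sum-syntax; sum-cong-≗; sum-replicate-zero; ∑-distrib-+; ∑-comm)
open import Algebra.Properties.CommutativeSemigroup (CommutativeRing.*-commutativeSemigroup ℚₚ.+-*-commutativeRing)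
  using () renaming (interchange to *-interchange)
import Algebra.Properties.Monoid.Sum ℚₚ.+-0-monoid as ℚΣ
open import Algebra.Properties.Semiring.Sum ℕₚ.+-*-semiring using (*-distribˡ-sum)
open import Data.Bool using (Bool; true; false; if_then_else_; _∧_; _∨_; not; T)
open import Data.Bool.Properties using (T-∧; T-∨; T-≡; T?; ∧-comm; ∧-assoc)
open import Data.Empty using (⊥; ⊥-elim)
open import Data.Fin using (Fin; zero; suc)
open import Data.Fin.Properties using (_≟_; any?; injective⇒≤)
open import Data.Fin.Subset using (Subset; _∈_; _∉_; ∣_∣)
import Data.Integer as ℤ
open import Data.List as List using (List; []; _∷_; [_])
import Data.List.Properties as Listₚ
open import Data.List.Membership.Propositional.Properties using (∈-lookup)
open import Data.List.Relation.Unary.All as All using (All; []; _∷_)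
open import Data.List.Relation.Unary.AllPairs using (_∷_)
open import Data.List.Relation.Unary.Linked using (Linked; [-]; _∷_)
open import Data.List.Relation.Unary.Unique.Propositional using (Unique)
open import Data.Maybe using (just; nothing)
open import Data.Nat using (ℕ; zero; suc; _+_; _*_; _^_; _≤_; _<_; z≤n; s≤s)
open import Data.Nat.Tactic.RingSolver using (solve-∀)
open import Data.Product using (Σ; ∃; _×_; _,_; proj₁; proj₂)
open import Data.Rational as ℚ using (ℚ; 0ℚ; 1ℚ; ½)
open import Data.Sum using (_⊎_; inj₁; inj₂)
open import Data.Unit using (tt)
import Data.Vec as Vec
import Data.Vec.Functional as Vector
open import Data.Vec.Properties using (lookup⇒[]=; []=⇒lookup)
open import Function using (_∘_; id)
open import Function.Bundles using (Equivalence)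
open import Relation.Binary.PropositionalEquality using (_≡_; refl; sym; trans; cong; cong₂; subst; module ≡-Reasoning)
open import Relation.Nullary using (¬_; yes; no)
open import Relation.Nullary.Decidable using (⌊_⌋; toWitness; fromWitness)

private
  variable
    n : ℕ

T-∧⁺ : ∀ {a b} → T a → T b → T (a ∧ b)
T-∧⁺ p q = Equivalence.from T-∧ (p , q)

T-∧⁻ : ∀ {a b} → T (a ∧ b) → T a × T b
T-∧⁻ = Equivalence.to T-∧

T-∨⁻ : ∀ {a b} → T (a ∨ b) → T a ⊎ T b
T-∨⁻ = Equivalence.to T-∨

∑-mono-≤ : {f g : Fin n → ℕ} → (∀ x → f x ≤ g x) → sum f ≤ sum g
∑-mono-≤ {zero}  f≤g = z≤n
∑-mono-≤ {suc n} f≤g = ℕₚ.+-mono-≤ (f≤g zero) (∑-mono-≤ (f≤g ∘ suc))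

∑-mono-< : {f g : Fin n → ℕ} → (∀ x → f x ≤ g x) → ∀ z → f z < g z → sum f < sum g
∑-mono-< f≤g zero    fz<gz = ℕₚ.+-mono-<-≤ fz<gz (∑-mono-≤ (f≤g ∘ suc))
∑-mono-< f≤g (suc z) fz<gz = ℕₚ.+-mono-≤-< (f≤g zero) (∑-mono-< (f≤g ∘ suc) z fz<gz)

term≤∑ : (f : Fin n → ℕ) → ∀ z → f z ≤ sum f
term≤∑ f zero    = ℕₚ.m≤m+n (f zero) _
term≤∑ f (suc z) = ℕₚ.≤-trans (term≤∑ (f ∘ suc) z) (ℕₚ.m≤n+m _ (f zero))

∑-1 : ∀ n → ∑[ x < n ] 1 ≡ n
∑-1 zero    = refl
∑-1 (suc n) = cong suc (∑-1 n)

indicator : Bool → ℕ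
indicator b = if b then 1 else 0

indicator-mono : ∀ {a b} → (T a → T b) → indicator a ≤ indicator b
indicator-mono {false}         _   = z≤n
indicator-mono {true} {true}   _   = ℕₚ.≤-refl
indicator-mono {true} {false} a⇒b = ⊥-elim (a⇒b tt)

indicator-T : ∀ {b} → T b → indicator b ≡ 1
indicator-T {true} _ = refl

indicator-¬T : ∀ {b} → ¬ T b → indicator b ≡ 0
indicator-¬T {true}  ¬b = ⊥-elim (¬b tt)
indicator-¬T {false} _  = refl

VSet : ℕ → Set
VSet n = Fin n → Bool

_∩_ _∪_ _─_ : VSet n → VSet n → VSet n
(U ∩ W) x = U x ∧ W x
(U ∪ W) x = U x ∨ W x
(U ─ W) x = U x ∧ not (W x)

_⊆_ : VSet n → VSet n → Set
U ⊆ W = ∀ {x} → T (U x) → T (W x)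

∩-⊆ˡ : (U W : VSet n) → (U ∩ W) ⊆ U
∩-⊆ˡ U W {x} = proj₁ ∘ T-∧⁻ {U x}

⁅_⁆ : Fin n → VSet n
⁅ u ⁆ x = ⌊ x ≟ u ⌋

any : VSet n → Bool
any U = ⌊ any? (λ x → T? (U x)) ⌋

any-intro : (U : VSet n) {x : Fin n} → T (U x) → T (any U)
any-intro U {x} Ux = fromWitness (x , Ux)

any-elim : (U : VSet n) → T (any U) → ∃ λ x → T (U x)
any-elim U = toWitness

T-─⁺ : (U W : VSet n) {x : Fin n} → T (U x) → ¬ T (W x) → T ((U ─ W) x)
T-─⁺ U W {x} Ux ¬Wx with W x
... | true  = ⊥-elim (¬Wx tt)
... | false = T-∧⁺ Ux tt

T-─⁻ : (U W : VSet n) {x : Fin n} → T ((U ─ W) x) → T (U x) × ¬ T (W x)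
T-─⁻ U W {x} p with W x | T-∧⁻ {U x} p
... | false | Ux , _ = Ux , λ ()

sumOver : VSet n → (Fin n → ℕ) → ℕ
sumOver {n} U f = ∑[ x < n ] (if U x then f x else 0)

syntax sumOver U (λ x → e) = ∑[ x ∈ U ] e

count : VSet n → ℕ
count U = ∑[ x ∈ U ] 1

sumOver-mono : (U : VSet n) {f g : Fin n → ℕ} → (∀ {x} → T (U x) → f x ≤ g x) →
  ∑[ x ∈ U ] f x ≤ ∑[ x ∈ U ] g x
sumOver-mono U f≤g = ∑-mono-≤ λ x → if-mono (U x) f≤g
  where
  if-mono : ∀ b {p q} → (T b → p ≤ q) → (if b then p else 0) ≤ (if b then q else 0)
  if-mono true  p≤q = p≤q tt
  if-mono false _   = z≤n

sumOver-split : (U C : VSet n) (f : Fin n → ℕ) → C ⊆ U →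
  ∑[ x ∈ U ] f x ≡ ∑[ x ∈ C ] f x + ∑[ x ∈ U ─ C ] f x
sumOver-split U C f C⊆U =
  trans (sum-cong-≗ λ x → if-split (U x) (C x) C⊆U) (∑-distrib-+ (λ x → if C x then f x else 0) _)
  where
  if-split : ∀ u c {p} → (T c → T u) →
    (if u then p else 0) ≡ (if c then p else 0) + (if u ∧ not c then p else 0)
  if-split true  true  _   = sym (ℕₚ.+-identityʳ _)
  if-split true  false _   = refl
  if-split false false _   = refl
  if-split false true  c⇒u = ⊥-elim (c⇒u tt)

sumOver-const : (U : VSet n) (c : ℕ) → ∑[ x ∈ U ] c ≡ c * count U
sumOver-const U c = sym (trans (*-distribˡ-sum c (indicator ∘ U)) (sum-cong-≗ λ x → scale (U x)))
  where
  scale : ∀ b → c * indicator b ≡ (if b then c else 0)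
  scale true  = ℕₚ.*-identityʳ c
  scale false = ℕₚ.*-zeroʳ c

sumOver-count : (U : VSet n) (V : Fin n → VSet n) →
  ∑[ x ∈ U ] count (V x) ≡ ∑[ x < n ] count (λ y → U x ∧ V x y)
sumOver-count {n} U V = sum-cong-≗ λ x → pull (U x)
  where
  pull : ∀ {x} b → (if b then count (V x) else 0) ≡ count (λ y → b ∧ V x y)
  pull true  = refl
  pull false = sym (sum-replicate-zero n)

count-mono : (U W : VSet n) → U ⊆ W → count U ≤ count W
count-mono U W U⊆W = ∑-mono-≤ λ x → indicator-mono {U x} {W x} U⊆W

count-mono-< : (U W : VSet n) → U ⊆ W → ∀ {z} → T (W z) → ¬ T (U z) → count U < count W
count-mono-< U W U⊆W {z} Wz ¬Uz = ∑-mono-< (λ x → indicator-mono {U x} {W x} U⊆W) z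
  (ℕₚ.≤-reflexive (trans (cong suc (indicator-¬T ¬Uz)) (sym (indicator-T Wz))))

count-∪ : (U W : VSet n) → (∀ {x} → T (U x) → T (W x) → ⊥) →
  count (U ∪ W) ≡ count U + count W
count-∪ U W disjoint = trans (sum-cong-≗ λ x → indicator-∨ (U x) (W x) disjoint) (∑-distrib-+ (indicator ∘ U) _)
  where
  indicator-∨ : ∀ u w → (T u → T w → ⊥) → indicator (u ∨ w) ≡ indicator u + indicator w
  indicator-∨ true  true  u⇏w = ⊥-elim (u⇏w tt tt)
  indicator-∨ true  false _   = refl
  indicator-∨ false _     _   = refl

count-not+count : (U : VSet n) → count (λ x → not (U x)) + count U ≡ n
count-not+count {n} U =
  trans (sym (∑-distrib-+ (indicator ∘ not ∘ U) _)) (trans (sum-cong-≗ λ x → one (U x)) (∑-1 n))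
  where
  one : ∀ b → indicator (not b) + indicator b ≡ 1
  one true  = refl
  one false = refl

count≤n : (U : VSet n) → count U ≤ n
count≤n {n} U = ℕₚ.≤-trans (∑-mono-≤ λ x → indicator-mono {U x} {true} _) (ℕₚ.≤-reflexive (∑-1 n))

count-pos : (U : VSet n) {x : Fin n} → T (U x) → 0 < count U
count-pos U {x} Ux = ℕₚ.≤-trans (ℕₚ.≤-reflexive (sym (indicator-T Ux))) (term≤∑ (indicator ∘ U) x)

count-empty : (U : VSet n) → (∀ x → ¬ T (U x)) → count U ≡ 0
count-empty {n} U ¬U = trans (sum-cong-≗ λ x → indicator-¬T (¬U x)) (sum-replicate-zero n)

count-⁅⁆ : (u : Fin n) → count ⁅ u ⁆ ≡ 1
count-⁅⁆ {suc n} zero    = cong suc (count-empty {n} (λ x → ⌊ suc x ≟ zero ⌋) λ x ())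
count-⁅⁆ {suc n} (suc u) = trans (sum-cong-≗ λ x → cong indicator (≟-suc x)) (count-⁅⁆ u)
  where
  ≟-suc : ∀ x → ⌊ suc x ≟ suc u ⌋ ≡ ⌊ x ≟ u ⌋
  ≟-suc x with x ≟ u
  ... | yes _ = refl
  ... | no  _ = refl

count≤1 : (U : VSet n) (u : Fin n) → (∀ {x} → T (U x) → x ≡ u) → count U ≤ 1
count≤1 U u single = ℕₚ.≤-trans (count-mono U ⁅ u ⁆ (fromWitness ∘ single)) (ℕₚ.≤-reflexive (count-⁅⁆ u))

count≤∑count : (A : Fin n → VSet n) (P Q : VSet n) →
  (∀ {y} → T (Q y) → ∃ λ x → T (P x) × T (A x y)) →
  count Q ≤ ∑[ x ∈ P ] count (A x ∩ Q)
count≤∑count {n} A P Q covered = begin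
  count Q                                       ≤⟨ ∑-mono-≤ (λ y → indicator-≤ (Q y) (covered-once y)) ⟩
  ∑[ y < n ] count (λ x → P x ∧ (A x ∩ Q) y)    ≡⟨ ∑-comm (λ x y → indicator (P x ∧ (A x ∩ Q) y)) ⟨
  ∑[ x < n ] count (λ y → P x ∧ (A x ∩ Q) y)    ≡⟨ sumOver-count P (λ x → A x ∩ Q) ⟨
  ∑[ x ∈ P ] count (A x ∩ Q)                    ∎
  where
  open ℕₚ.≤-Reasoning
  indicator-≤ : ∀ b {m} → (T b → 1 ≤ m) → indicator b ≤ m
  indicator-≤ true  1≤m = 1≤m tt
  indicator-≤ false _   = z≤n
  covered-once : ∀ y → T (Q y) → 1 ≤ count (λ x → P x ∧ (A x ∩ Q) y)
  covered-once y Qy =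
    let (x , Px , Axy) = covered Qy
    in count-pos (λ x → P x ∧ (A x ∩ Q) y) (T-∧⁺ Px (T-∧⁺ Axy Qy))

deg : Graph n → Fin n → ℕ
deg G x = count (adj G x)

edges : Graph n → VSet n → VSet n → ℕ
edges G U W = ∑[ x ∈ U ] count (adj G x ∩ W)

edges-comm : (G : Graph n) (U W : VSet n) → edges G U W ≡ edges G W U
edges-comm {n} G U W = begin
  edges G U W                                         ≡⟨ sumOver-count U (λ x → adj G x ∩ W) ⟩
  ∑[ x < n ] count (λ y → U x ∧ (adj G x y ∧ W y))    ≡⟨ ∑-comm (λ x y → indicator (U x ∧ (adj G x y ∧ W y))) ⟩
  ∑[ y < n ] count (λ x → U x ∧ (adj G x y ∧ W y))    ≡⟨ sum-cong-≗ (λ y → sum-cong-≗ λ x → cong indicator (mirror x y)) ⟩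
  ∑[ y < n ] count (λ x → W y ∧ (adj G y x ∧ U x))    ≡⟨ sumOver-count W (λ y → adj G y ∩ U) ⟨
  edges G W U                                         ∎
  where
  open ≡-Reasoning
  mirror : ∀ x y → U x ∧ (adj G x y ∧ W y) ≡ W y ∧ (adj G y x ∧ U x)
  mirror x y = begin
    U x ∧ (adj G x y ∧ W y)  ≡⟨ cong (λ b → U x ∧ (b ∧ W y)) (symm G x y) ⟩
    U x ∧ (adj G y x ∧ W y)  ≡⟨ cong (U x ∧_) (∧-comm (adj G y x) (W y)) ⟩
    U x ∧ (W y ∧ adj G y x)  ≡⟨ ∧-comm (U x) _ ⟩
    (W y ∧ adj G y x) ∧ U x  ≡⟨ ∧-assoc (W y) _ _ ⟩
    W y ∧ (adj G y x ∧ U x)  ∎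

edges≤3count : (G : Graph n) → (∀ x → deg G x ≤ 3) → (U W : VSet n) → edges G U W ≤ 3 * count U
edges≤3count G deg≤3 U W = begin
  edges G U W   ≤⟨ sumOver-mono U (λ {x} _ → ℕₚ.≤-trans (count-mono (adj G x ∩ W) (adj G x) (∩-⊆ˡ (adj G x) W)) (deg≤3 x)) ⟩
  ∑[ x ∈ U ] 3  ≡⟨ sumOver-const U 3 ⟩
  3 * count U   ∎
  where open ℕₚ.≤-Reasoning

Adj-sym : (G : Graph n) {x y : Fin n} → Adj G x y → Adj G y x
Adj-sym G {x} {y} = subst T (symm G x y)

N : Graph n → VSet n → VSet n
N G U y = any (λ x → U x ∧ adj G x y)

N-intro : (G : Graph n) (U : VSet n) {x y : Fin n} → T (U x) → Adj G x y → T (N G U y)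
N-intro G U Ux xy = any-intro _ (T-∧⁺ Ux xy)

N-elim : (G : Graph n) (U : VSet n) {y : Fin n} → T (N G U y) → ∃ λ x → T (U x) × Adj G x y
N-elim G U Ny = let (x , p) = any-elim _ Ny in x , T-∧⁻ p

N-mono : (G : Graph n) (U W : VSet n) → U ⊆ W → N G U ⊆ N G W
N-mono G U W U⊆W {y} p = let (x , Ux , xy) = N-elim G U {y} p in N-intro G W (U⊆W Ux) xy

Closed : Graph n → VSet n → VSet n → Set
Closed G S U = ∀ {x y} → T (U x) → Adj G x y → T (not (S y)) → T (U y)

Closed-─ : (G : Graph n) (S U C : VSet n) → Closed G S U → U ⊆ (not ∘ S) → Closed G S C →
  Closed G S (U ─ C)
Closed-─ G S U C U-closed U⊆H C-closed {x} p xy Hy =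
  let (Ux , ¬Cx) = T-─⁻ U C {x} p
  in T-─⁺ U C (U-closed Ux xy Hy) (λ Cy → ¬Cx (C-closed Cy (Adj-sym G xy) (U⊆H Ux)))

module Exploration (G : Graph n) (S : VSet n) (u : Fin n) where

  H : VSet n
  H x = not (S x)

  -- ball r: the vertices joined to u by a walk in G[H] with fewer than r edges (so ball 0 = ∅);
  -- reach r: the vertices of S at (G,S)-distance at most r from u.
  ball : ℕ → VSet n
  ball zero    _ = false
  ball (suc r)   = ⁅ u ⁆ ∪ (H ∩ N G (ball r))

  reach : ℕ → VSet n
  reach r = S ∩ N G (ball r)

  N-ball₀ : ∀ y → ¬ T (N G (ball 0) y)
  N-ball₀ y p = proj₁ (proj₂ (N-elim G (ball 0) {y} p))

  sphere newReach frontier : ℕ → VSet n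
  sphere   r = ball (suc r) ─ ball r
  newReach r = reach (suc r) ─ reach r
  frontier r = newReach r ∪ sphere (suc r)

  ball-suc⁻ : ∀ r {y} → T (ball (suc r) y) → y ≡ u ⊎ (T (H y) × T (N G (ball r) y))
  ball-suc⁻ r {y} p with T-∨⁻ {⁅ u ⁆ y} p
  ... | inj₁ y≟u = inj₁ (toWitness y≟u)
  ... | inj₂ q   = inj₂ (T-∧⁻ q)

  u∈ball : ∀ r → T (ball (suc r) u)
  u∈ball r with u ≟ u
  ... | yes _   = tt
  ... | no  u≢u = ⊥-elim (u≢u refl)

  ball-step : ∀ r {x y} → T (ball r x) → Adj G x y → T (H y) → T (ball (suc r) y)
  ball-step r {y = y} bx xy Hy with ⁅ u ⁆ y
  ... | true  = tt
  ... | false = T-∧⁺ Hy (N-intro G (ball r) bx xy)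

  ball-mono : ∀ r → ball r ⊆ ball (suc r)
  ball-mono (suc r) {y} p with ball-suc⁻ r p
  ... | inj₁ refl          = u∈ball (suc r)
  ... | inj₂ (Hy , Nby) with N-elim G (ball r) Nby
  ...   | x , bx , xy = ball-step (suc r) (ball-mono r bx) xy Hy

  ball⊆closed : (U : VSet n) → Closed G S U → T (U u) → ∀ r → ball r ⊆ U
  ball⊆closed U closed Uu (suc r) p with ball-suc⁻ r p
  ... | inj₁ refl = Uu
  ... | inj₂ (Hy , Nby) with N-elim G (ball r) Nby
  ...   | x , bx , xy = closed (ball⊆closed U closed Uu r bx) xy Hy

  ball₁⊆⁅u⁆ : ∀ {x} → T (ball 1 x) → x ≡ u
  ball₁⊆⁅u⁆ {x} p with ball-suc⁻ 0 {x} p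
  ... | inj₁ x≡u        = x≡u
  ... | inj₂ (_ , Nb₀x) = ⊥-elim (N-ball₀ x Nb₀x)

  sphere⊆ball : ∀ r → sphere r ⊆ ball (suc r)
  sphere⊆ball r {x} = proj₁ ∘ T-─⁻ (ball (suc r)) (ball r) {x}

  reach-mono : ∀ r → reach r ⊆ reach (suc r)
  reach-mono r {y} p =
    let (Sy , Nby) = T-∧⁻ {S y} p in T-∧⁺ Sy (N-mono G (ball r) (ball (suc r)) (ball-mono r) Nby)

  S-H-disjoint : ∀ {y} → T (S y) → T (H y) → ⊥
  S-H-disjoint {y} Sy Hy with S y
  ... | true  = Hy
  ... | false = Sy

  reach⊆S : ∀ r → reach r ⊆ S
  reach⊆S r {x} = proj₁ ∘ T-∧⁻ {S x}

  newReach⊆S : ∀ r → newReach r ⊆ S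
  newReach⊆S r {x} = reach⊆S (suc r) ∘ proj₁ ∘ T-─⁻ (reach (suc r)) (reach r) {x}

  frontier-pred : ∀ r {y} → T (frontier r y) → ∃ λ x → T (sphere r x) × Adj G x y
  frontier-pred r {y} p with T-∨⁻ {newReach r y} p
  ... | inj₂ new-y with T-─⁻ (ball (suc (suc r))) (ball (suc r)) {y} new-y
  ...   | b₂y , ¬b₁y with ball-suc⁻ (suc r) {y} b₂y
  ...     | inj₁ refl = ⊥-elim (¬b₁y (u∈ball r))
  ...     | inj₂ (Hy , Nb₁y) =
    let (x , b₁x , xy) = N-elim G (ball (suc r)) Nb₁y
    in x , T-─⁺ (ball (suc r)) (ball r) b₁x (λ b₀x → ¬b₁y (ball-step r b₀x xy Hy)) , xy
  frontier-pred r {y} p | inj₁ new-y with T-─⁻ (reach (suc r)) (reach r) {y} new-y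
  ... | r₁y , ¬r₀y =
    let (Sy , Nb₁y) = T-∧⁻ {S y} r₁y
        (x , b₁x , xy) = N-elim G (ball (suc r)) Nb₁y
    in x , T-─⁺ (ball (suc r)) (ball r) b₁x (λ b₀x → ¬r₀y (T-∧⁺ Sy (N-intro G (ball r) b₀x xy))) , xy

  a b : ℕ → ℕ
  a r = count (sphere r)
  b r = count (newReach r)

  count-ball-suc : ∀ r → count (ball (2 + r)) ≡ count (ball (1 + r)) + a (1 + r)
  count-ball-suc r = sumOver-split (ball (2 + r)) (ball (1 + r)) (λ _ → 1) (ball-mono (suc r))

  count-reach-suc : ∀ r → count (reach (suc r)) ≡ count (reach r) + b r
  count-reach-suc r = sumOver-split (reach (suc r)) (reach r) (λ _ → 1) (reach-mono r)

  count-reach₀ : count (reach 0) ≡ 0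
  count-reach₀ = count-empty (reach 0) λ y p → N-ball₀ y (proj₂ (T-∧⁻ {S y} p))

  frontier≤edges : ∀ r → count (frontier r) ≤ edges G (sphere r) (frontier r)
  frontier≤edges r = count≤∑count (adj G) (sphere r) (frontier r) (frontier-pred r)

  -- score r v is 2^(r-1-j) if v ∈ newReach j for some j < r, i.e. dist(u, v) = j + 1, and 0
  -- otherwise; so for r ≥ 1, fromℕ (Score r) · (1/2)^(r-1) is the part of w(u) from distances ≤ r.
  score : ℕ → Fin n → ℕ
  score zero    v = 0
  score (suc r) v = 2 * score r v + indicator (newReach r v)

  Score : ℕ → ℕ
  Score r = sum (score r)

  Score-suc : ∀ r → Score (suc r) ≡ 2 * Score r + b r
  Score-suc r = trans (∑-distrib-+ (λ v → 2 * score r v) (indicator ∘ newReach r))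
                      (cong (_+ b r) (sym (*-distribˡ-sum 2 (score r))))

  reach⇒score-pos : ∀ r {v} → T (reach r v) → 1 ≤ score r v
  reach⇒score-pos zero    {v} p = ⊥-elim (N-ball₀ v (proj₂ (T-∧⁻ {S v} p)))
  reach⇒score-pos (suc r) {v} p with T? (reach r v)
  ... | yes q  = ℕₚ.≤-trans (reach⇒score-pos r q)
                   (ℕₚ.≤-trans (ℕₚ.m≤m+n (score r v) _) (ℕₚ.m≤m+n (2 * score r v) _))
  ... | no  ¬q = ℕₚ.≤-trans (ℕₚ.≤-reflexive (sym (indicator-T (T-─⁺ (reach (suc r)) (reach r) p ¬q))))
                   (ℕₚ.m≤n+m _ (2 * score r v))

  reach⇒score : ∀ r {v} → T (reach r v) → ∀ k → 2 ^ k ≤ score (k + r) v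
  reach⇒score r p zero    = reach⇒score-pos r p
  reach⇒score r {v} p (suc k) =
    ℕₚ.≤-trans (ℕₚ.*-monoʳ-≤ 2 (reach⇒score r p k)) (ℕₚ.m≤m+n (2 * score (k + r) v) _)

  module _ (u∉S : T (H u)) where

    ball⊆H : ∀ r → ball r ⊆ H
    ball⊆H (suc r) p with ball-suc⁻ r p
    ... | inj₁ refl     = u∉S
    ... | inj₂ (Hy , _) = Hy

    ball∩frontier-empty : ∀ r {z} → T (ball (suc r) z) → ¬ T (frontier r z)
    ball∩frontier-empty r {z} bz fz with T-∨⁻ {newReach r z} fz
    ... | inj₁ nz = S-H-disjoint (newReach⊆S r nz) (ball⊆H (suc r) bz)
    ... | inj₂ sz = proj₂ (T-─⁻ (ball (suc (suc r))) (ball (suc r)) {z} sz) bz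

    count-frontier : ∀ r → count (frontier r) ≡ b r + a (suc r)
    count-frontier r = count-∪ (newReach r) (sphere (suc r)) λ ny sy →
      S-H-disjoint (newReach⊆S r ny) (ball⊆H (suc (suc r)) (sphere⊆ball (suc r) sy))

    module _ (deg≤3 : ∀ x → deg G x ≤ 3) where

      frontier-first : b 0 + a 1 ≤ 3
      frontier-first = begin
        b 0 + a 1                           ≡⟨ count-frontier 0 ⟨
        count (frontier 0)                  ≤⟨ frontier≤edges 0 ⟩
        edges G (sphere 0) (frontier 0)     ≤⟨ edges≤3count G deg≤3 (sphere 0) (frontier 0) ⟩
        3 * a 0                             ≤⟨ ℕₚ.*-monoʳ-≤ 3 (count≤1 (sphere 0) u sphere₀⊆⁅u⁆) ⟩
        3                                   ∎
        where
        open ℕₚ.≤-Reasoning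
        sphere₀⊆⁅u⁆ : ∀ {x} → T (sphere 0 x) → x ≡ u
        sphere₀⊆⁅u⁆ = ball₁⊆⁅u⁆ ∘ sphere⊆ball 0

      frontier-next : ∀ r → b (1 + r) + a (2 + r) ≤ 2 * a (1 + r)
      frontier-next r = begin
        b (1 + r) + a (2 + r)                              ≡⟨ count-frontier (suc r) ⟨
        count (frontier (suc r))                           ≤⟨ frontier≤edges (suc r) ⟩
        edges G (sphere (suc r)) (frontier (suc r))        ≤⟨ sumOver-mono (sphere (suc r)) at-most-two ⟩
        ∑[ x ∈ sphere (suc r) ] 2                          ≡⟨ sumOver-const (sphere (suc r)) 2 ⟩
        2 * a (suc r)                                      ∎
        where
        open ℕₚ.≤-Reasoning
        at-most-two : ∀ {x} → T (sphere (suc r) x) → count (adj G x ∩ frontier (suc r)) ≤ 2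
        at-most-two {x} sx =
          let (z , sz , zx) = frontier-pred r {x} (Equivalence.from T-∨ (inj₂ sx))
              z∉frontier = ball∩frontier-empty (suc r) (ball-mono (suc r) (sphere⊆ball r sz))
          in ℕₚ.≤-pred (ℕₚ.≤-trans
               (count-mono-< (adj G x ∩ frontier (suc r)) (adj G x) (∩-⊆ˡ (adj G x) (frontier (suc r)))
                  (Adj-sym G zx) (z∉frontier ∘ proj₂ ∘ T-∧⁻))
               (deg≤3 x))

      Score+sphere : ∀ J → Score (suc J) + a (suc J) ≤ 3 * 2 ^ J
      Score+sphere zero    = frontier-first
      Score+sphere (suc J) = begin
        Score (2 + J) + a (2 + J)                  ≡⟨ cong (_+ a (2 + J)) (Score-suc (suc J)) ⟩
        2 * Score (1 + J) + b (1 + J) + a (2 + J)  ≡⟨ ℕₚ.+-assoc (2 * Score (1 + J)) _ _ ⟩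
        2 * Score (1 + J) + (b (1 + J) + a (2 + J)) ≤⟨ ℕₚ.+-monoʳ-≤ (2 * Score (1 + J)) (frontier-next J) ⟩
        2 * Score (1 + J) + 2 * a (1 + J)          ≡⟨ ℕₚ.*-distribˡ-+ 2 (Score (1 + J)) _ ⟨
        2 * (Score (1 + J) + a (1 + J))            ≤⟨ ℕₚ.*-monoʳ-≤ 2 (Score+sphere J) ⟩
        2 * (3 * 2 ^ J)                            ≡⟨ trans (sym (ℕₚ.*-assoc 2 3 (2 ^ J))) (ℕₚ.*-assoc 3 2 (2 ^ J)) ⟩
        3 * 2 ^ suc J                              ∎
        where open ℕₚ.≤-Reasoning

      ball+Score : ∀ J → 2 + count (ball (suc J)) + Score (suc J) ≤ 3 * 2 ^ J + count (reach (suc J))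
      ball+Score zero = begin
        2 + count (ball 1) + b 0   ≤⟨ ℕₚ.+-monoˡ-≤ (b 0) (ℕₚ.+-monoʳ-≤ 2 (count≤1 (ball 1) u ball₁⊆⁅u⁆)) ⟩
        3 + b 0                    ≡⟨ cong (λ c → 3 + (c + b 0)) count-reach₀ ⟨
        3 + (count (reach 0) + b 0) ≡⟨ cong (3 +_) (count-reach-suc 0) ⟨
        3 + count (reach 1)        ∎
        where open ℕₚ.≤-Reasoning
      ball+Score (suc J) = begin
        2 + count (ball (2 + J)) + Score (2 + J)
          ≡⟨ cong₂ (λ c s → 2 + c + s) (count-ball-suc J) (Score-suc (suc J)) ⟩
        2 + (count (ball (1 + J)) + a (1 + J)) + (2 * Score (1 + J) + b (1 + J))
          ≡⟨ regroup (count (ball (1 + J))) (a (1 + J)) (Score (1 + J)) (b (1 + J)) ⟩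
        (2 + count (ball (1 + J)) + Score (1 + J)) + (Score (1 + J) + a (1 + J)) + b (1 + J)
          ≤⟨ ℕₚ.+-monoˡ-≤ (b (1 + J)) (ℕₚ.+-mono-≤ (ball+Score J) (Score+sphere J)) ⟩
        (3 * 2 ^ J + count (reach (1 + J))) + 3 * 2 ^ J + b (1 + J)
          ≡⟨ collect (2 ^ J) (count (reach (1 + J))) (b (1 + J)) ⟩
        3 * 2 ^ suc J + (count (reach (1 + J)) + b (1 + J))
          ≡⟨ cong (3 * 2 ^ suc J +_) (count-reach-suc (suc J)) ⟨
        3 * 2 ^ suc J + count (reach (2 + J))
          ∎
        where
        open ℕₚ.≤-Reasoning
        regroup : ∀ c α σ β → 2 + (c + α) + (2 * σ + β) ≡ (2 + c + σ) + (σ + α) + β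
        regroup = solve-∀
        collect : ∀ q ρ β → 3 * q + ρ + 3 * q + β ≡ 3 * (2 * q) + (ρ + β)
        collect = solve-∀

      module _ (K : ℕ) (saturated : 3 * 2 ^ K ≤ Score (suc K)) where

        sphere-empty : a (suc K) ≡ 0
        sphere-empty = ℕₚ.n≤0⇒n≡0 (ℕₚ.+-cancelˡ-≤ (Score (suc K)) _ 0 (begin
          Score (suc K) + a (suc K)  ≤⟨ Score+sphere K ⟩
          3 * 2 ^ K                  ≤⟨ saturated ⟩
          Score (suc K)              ≡⟨ ℕₚ.+-identityʳ _ ⟨
          Score (suc K) + 0          ∎))
          where open ℕₚ.≤-Reasoning

        ball-closed : Closed G S (ball (suc K))
        ball-closed {x} {y} bx xy Hy with T? (ball (suc K) y)
        ... | yes by = by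
        ... | no ¬by = ⊥-elim (ℕₚ.<⇒≢ (count-pos (sphere (suc K)) {y} sy) (sym sphere-empty))
          where
          sy : T (sphere (suc K) y)
          sy = T-─⁺ (ball (2 + K)) (ball (1 + K)) (ball-step (suc K) bx xy Hy) ¬by

        reach-large : 2 + count (ball (suc K)) ≤ count (reach (suc K))
        reach-large = ℕₚ.+-cancelʳ-≤ (Score (suc K)) _ _ (begin
          2 + count (ball (suc K)) + Score (suc K)  ≤⟨ ball+Score K ⟩
          3 * 2 ^ K + count (reach (suc K))         ≤⟨ ℕₚ.+-monoˡ-≤ _ saturated ⟩
          Score (suc K) + count (reach (suc K))     ≡⟨ ℕₚ.+-comm (Score (suc K)) _ ⟩
          count (reach (suc K)) + Score (suc K)     ∎)
          where open ℕₚ.≤-Reasoning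

        reach≤edges : count (reach (suc K)) ≤ edges G (ball (suc K)) S
        reach≤edges = begin
          count (reach (suc K))
            ≤⟨ count≤∑count (adj G) (ball (suc K)) (reach (suc K)) (λ {y} p → N-elim G (ball (suc K)) (proj₂ (T-∧⁻ {S y} p))) ⟩
          ∑[ x ∈ ball (suc K) ] count (adj G x ∩ reach (suc K))
            ≤⟨ sumOver-mono (ball (suc K)) (λ {x} _ → count-mono (adj G x ∩ reach (suc K)) (adj G x ∩ S) (restrict x)) ⟩
          edges G (ball (suc K)) S
            ∎
          where
          open ℕₚ.≤-Reasoning
          restrict : ∀ x → (adj G x ∩ reach (suc K)) ⊆ (adj G x ∩ S)
          restrict x {y} p = let (xy , ry) = T-∧⁻ {adj G x y} p in T-∧⁺ xy (reach⊆S (suc K) ry)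

fromℕ : ℕ → ℚ
fromℕ zero    = 0ℚ
fromℕ (suc m) = 1ℚ ℚ.+ fromℕ m

fromℕ-+ : ∀ m k → fromℕ (m + k) ≡ fromℕ m ℚ.+ fromℕ k
fromℕ-+ zero    k = sym (ℚₚ.+-identityˡ (fromℕ k))
fromℕ-+ (suc m) k = trans (cong (1ℚ ℚ.+_) (fromℕ-+ m k)) (sym (ℚₚ.+-assoc 1ℚ (fromℕ m) (fromℕ k)))

fromℕ-* : ∀ m k → fromℕ (m * k) ≡ fromℕ m ℚ.* fromℕ k
fromℕ-* zero    k = sym (ℚₚ.*-zeroˡ (fromℕ k))
fromℕ-* (suc m) k = begin
  fromℕ (k + m * k)                          ≡⟨ fromℕ-+ k (m * k) ⟩
  fromℕ k ℚ.+ fromℕ (m * k)                  ≡⟨ cong₂ ℚ._+_ (sym (ℚₚ.*-identityˡ (fromℕ k))) (fromℕ-* m k) ⟩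
  1ℚ ℚ.* fromℕ k ℚ.+ fromℕ m ℚ.* fromℕ k     ≡⟨ ℚₚ.*-distribʳ-+ (fromℕ k) 1ℚ (fromℕ m) ⟨
  (1ℚ ℚ.+ fromℕ m) ℚ.* fromℕ k               ∎
  where open ≡-Reasoning

0≤1 : 0ℚ ℚ.≤ 1ℚ
0≤1 = ℚ.*≤* (ℤ.+≤+ z≤n)

0<1 : 0ℚ ℚ.< 1ℚ
0<1 = ℚ.*<* (ℤ.+<+ (s≤s z≤n))

fromℕ-nonNeg : ∀ m → 0ℚ ℚ.≤ fromℕ m
fromℕ-nonNeg zero    = ℚₚ.≤-refl
fromℕ-nonNeg (suc m) = ℚₚ.+-mono-≤ 0≤1 (fromℕ-nonNeg m)

fromℕ-mono-≤ : ∀ {m k} → m ≤ k → fromℕ m ℚ.≤ fromℕ k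
fromℕ-mono-≤ {k = k} z≤n   = fromℕ-nonNeg k
fromℕ-mono-≤ (s≤s m≤k)     = ℚₚ.+-monoʳ-≤ 1ℚ (fromℕ-mono-≤ m≤k)

fromℕ-mono-< : ∀ {m k} → m < k → fromℕ m ℚ.< fromℕ k
fromℕ-mono-< {m} m<k = ℚₚ.<-≤-trans m<1+m (fromℕ-mono-≤ m<k)
  where
  m<1+m : fromℕ m ℚ.< 1ℚ ℚ.+ fromℕ m
  m<1+m = ℚₚ.≤-<-trans (ℚₚ.≤-reflexive (sym (ℚₚ.+-identityˡ (fromℕ m)))) (ℚₚ.+-monoˡ-< (fromℕ m) 0<1)

fromℕ-cancel-≤ : ∀ {m k} → fromℕ m ℚ.≤ fromℕ k → m ≤ k
fromℕ-cancel-≤ {m} {k} le with m ℕₚ.≤? k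
... | yes m≤k = m≤k
... | no  m≰k = ⊥-elim (ℚₚ.<-irrefl refl (ℚₚ.<-≤-trans (fromℕ-mono-< (ℕₚ.≰⇒> m≰k)) le))

halfPow-nonNeg : ∀ k → 0ℚ ℚ.≤ halfPow k
halfPow-nonNeg zero    = 0≤1
halfPow-nonNeg (suc k) =
  ℚₚ.≤-trans (ℚₚ.≤-reflexive (sym (ℚₚ.*-zeroʳ ½))) (ℚₚ.*-monoˡ-≤-nonNeg ½ (halfPow-nonNeg k))

halfPow-+ : ∀ d r → halfPow (d + r) ≡ halfPow d ℚ.* halfPow r
halfPow-+ zero    r = sym (ℚₚ.*-identityˡ (halfPow r))
halfPow-+ (suc d) r = trans (cong (½ ℚ.*_) (halfPow-+ d r)) (sym (ℚₚ.*-assoc ½ (halfPow d) (halfPow r)))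

halfPow-*-2^ : ∀ k → halfPow k ℚ.* fromℕ (2 ^ k) ≡ 1ℚ
halfPow-*-2^ zero    = refl
halfPow-*-2^ (suc k) = begin
  (½ ℚ.* halfPow k) ℚ.* fromℕ (2 * 2 ^ k)           ≡⟨ cong ((½ ℚ.* halfPow k) ℚ.*_) (fromℕ-* 2 (2 ^ k)) ⟩
  (½ ℚ.* halfPow k) ℚ.* (fromℕ 2 ℚ.* fromℕ (2 ^ k)) ≡⟨ *-interchange ½ (halfPow k) (fromℕ 2) (fromℕ (2 ^ k)) ⟩
  (½ ℚ.* fromℕ 2) ℚ.* (halfPow k ℚ.* fromℕ (2 ^ k)) ≡⟨ cong ((½ ℚ.* fromℕ 2) ℚ.*_) (halfPow-*-2^ k) ⟩
  1ℚ                                                ∎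
  where open ≡-Reasoning

halfPow-shift : ∀ d r → halfPow d ≡ fromℕ (2 ^ r) ℚ.* halfPow (d + r)
halfPow-shift d r = begin
  halfPow d                                         ≡⟨ ℚₚ.*-identityʳ (halfPow d) ⟨
  halfPow d ℚ.* 1ℚ                                  ≡⟨ cong (halfPow d ℚ.*_) (halfPow-*-2^ r) ⟨
  halfPow d ℚ.* (halfPow r ℚ.* fromℕ (2 ^ r))       ≡⟨ ℚₚ.*-assoc (halfPow d) _ _ ⟨
  (halfPow d ℚ.* halfPow r) ℚ.* fromℕ (2 ^ r)       ≡⟨ cong (ℚ._* fromℕ (2 ^ r)) (halfPow-+ d r) ⟨
  halfPow (d + r) ℚ.* fromℕ (2 ^ r)                 ≡⟨ ℚₚ.*-comm _ (fromℕ (2 ^ r)) ⟩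
  fromℕ (2 ^ r) ℚ.* halfPow (d + r)                 ∎
  where open ≡-Reasoning

fromℕ*halfPow-nonNeg : ∀ m k → 0ℚ ℚ.≤ fromℕ m ℚ.* halfPow k
fromℕ*halfPow-nonNeg m k = ℚₚ.≤-trans (ℚₚ.≤-reflexive (sym (ℚₚ.*-zeroˡ (halfPow k))))
  (ℚₚ.*-monoʳ-≤-nonNeg (halfPow k) {{ℚ.nonNegative (halfPow-nonNeg k)}} (fromℕ-nonNeg m))

∑ℚ-mono-≤ : {f g : Fin n → ℚ} → (∀ x → f x ℚ.≤ g x) → ℚΣ.sum f ℚ.≤ ℚΣ.sum g
∑ℚ-mono-≤ {zero}  f≤g = ℚₚ.≤-refl
∑ℚ-mono-≤ {suc n} f≤g = ℚₚ.+-mono-≤ (f≤g zero) (∑ℚ-mono-≤ (f≤g ∘ suc))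

∑ℚ-fromℕ-* : (f : Fin n → ℕ) (c : ℚ) → ℚΣ.sum (λ x → fromℕ (f x) ℚ.* c) ≡ fromℕ (sum f) ℚ.* c
∑ℚ-fromℕ-* {zero}  f c = sym (ℚₚ.*-zeroˡ c)
∑ℚ-fromℕ-* {suc n} f c = begin
  fromℕ (f zero) ℚ.* c ℚ.+ ℚΣ.sum (λ x → fromℕ (f (suc x)) ℚ.* c)  ≡⟨ cong (fromℕ (f zero) ℚ.* c ℚ.+_) (∑ℚ-fromℕ-* (f ∘ suc) c) ⟩
  fromℕ (f zero) ℚ.* c ℚ.+ fromℕ (sum (f ∘ suc)) ℚ.* c             ≡⟨ ℚₚ.*-distribʳ-+ c (fromℕ (f zero)) _ ⟨
  (fromℕ (f zero) ℚ.+ fromℕ (sum (f ∘ suc))) ℚ.* c                 ≡⟨ cong (ℚ._* c) (fromℕ-+ (f zero) _) ⟨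
  fromℕ (f zero + sum (f ∘ suc)) ℚ.* c                             ∎
  where open ≡-Reasoning

foldr-map-allFin : {A B : Set} (_⊕_ : A → B → B) (e : B) (f : Fin n → A) →
  List.foldr _⊕_ e (List.map f (List.allFin n)) ≡ Vector.foldr _⊕_ e f
foldr-map-allFin {n} _⊕_ e f = trans (cong (List.foldr _⊕_ e) (Listₚ.map-tabulate id f)) (foldr-tabulate f)
  where
  foldr-tabulate : ∀ {m} (g : Fin m → _) → List.foldr _⊕_ e (List.tabulate g) ≡ Vector.foldr _⊕_ e g
  foldr-tabulate {zero}  g = refl
  foldr-tabulate {suc m} g = cong (g zero ⊕_) (foldr-tabulate (g ∘ suc))

lookup-injective : {xs : List (Fin n)} → Unique xs → ∀ {i j} → List.lookup xs i ≡ List.lookup xs j → i ≡ j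
lookup-injective (_   ∷ u)  {zero}  {zero}  _  = refl
lookup-injective (x∉ ∷ _)   {zero}  {suc j} eq = ⊥-elim (All.lookup x∉ (∈-lookup j) eq)
lookup-injective (x∉ ∷ _)   {suc i} {zero}  eq = ⊥-elim (All.lookup x∉ (∈-lookup i) (sym eq))
lookup-injective (_   ∷ u)  {suc i} {suc j} eq = cong suc (lookup-injective u eq)

Unique⇒length≤ : {xs : List (Fin n)} → Unique xs → List.length xs ≤ n
Unique⇒length≤ u = injective⇒≤ (lookup-injective u)

∈⇒T : {S : Subset n} {x : Fin n} → x ∈ S → T (Vec.lookup S x)
∈⇒T x∈S = Equivalence.from T-≡ ([]=⇒lookup x∈S)

∉⇒T : (S : Subset n) {x : Fin n} → x ∉ S → T (not (Vec.lookup S x))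
∉⇒T S {x} x∉S with Vec.lookup S x in eq
... | true  = x∉S (lookup⇒[]= x S eq)
... | false = tt

degree≡deg : (G : Graph n) (x : Fin n) → degree G x ≡ deg G x
degree≡deg G x = foldr-map-allFin _+_ 0 (λ y → if adj G x y then 1 else 0)

∣S∣≡count : (S : Subset n) → ∣ S ∣ ≡ count (Vec.lookup S)
∣S∣≡count Vec.[]          = refl
∣S∣≡count (true  Vec.∷ S) = cong suc (∣S∣≡count S)
∣S∣≡count (false Vec.∷ S) = ∣S∣≡count S

T-not⇒∉ : (S : Subset n) {x : Fin n} → T (not (Vec.lookup S x)) → x ∉ S
T-not⇒∉ S x∉S x∈S = subst (T ∘ not) ([]=⇒lookup x∈S) x∉S

module Distances {K : ℕ} (G : Graph (suc K)) (S : Subset (suc K)) (u : Fin (suc K)) (u∉S : u ∉ S) where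

  open Exploration G (Vec.lookup S) u

  walk⇒reach : ∀ (mid : List (Fin (suc K))) j {x v} → T (ball (suc j) x) →
    Linked (Adj G) (x ∷ mid List.++ [ v ]) → All (_∉ S) mid → v ∈ S →
    T (reach (suc (List.length mid + j)) v)
  walk⇒reach []        j bx (xv ∷ [-]) []  v∈S = T-∧⁺ (∈⇒T v∈S) (N-intro G (ball (suc j)) bx xv)
  walk⇒reach (y ∷ mid) j {v = v} bx (xy ∷ walk) (y∉S ∷ mid∉S) v∈S =
    subst (λ i → T (reach (suc i) v)) (ℕₚ.+-suc (List.length mid) j)
      (walk⇒reach mid (suc j) (ball-step (suc j) bx xy (∉⇒T S y∉S)) walk mid∉S v∈S)

  path⇒reach : ∀ {v ℓ} → SPath G S u v ℓ → ∃ λ d → ℓ ≡ suc d × T (reach (suc d) v) × d ≤ K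
  path⇒reach (trivial u∈S) = ⊥-elim (u∉S u∈S)
  path⇒reach (nontrivial mid _ _ (inj₁ (u∈S , _)) _) = ⊥-elim (u∉S u∈S)
  path⇒reach {v} (nontrivial mid distinct walk (inj₂ (_ , v∈S)) mid∉S) =
    List.length mid , refl ,
    subst (λ i → T (reach (suc i) v)) (ℕₚ.+-identityʳ (List.length mid)) (walk⇒reach mid 0 (u∈ball 0) walk mid∉S v∈S) ,
    ℕₚ.≤-trans (Listₚ.length-++-≤ˡ mid) (ℕₚ.≤-pred (Unique⇒length≤ distinct))

  term≤score : ∀ v {m} → IsDist G S u v m → term m ℚ.≤ fromℕ (score (suc K) v) ℚ.* halfPow K
  term≤score v {nothing} _ = fromℕ*halfPow-nonNeg (score (suc K) v) K
  term≤score v {just ℓ} (path , _) with path⇒reach path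
  ... | d , refl , rv , d≤K with ℕₚ.m≤n⇒∃[o]m+o≡n d≤K
  ...   | r , refl = begin
    halfPow d                                          ≡⟨ halfPow-shift d r ⟩
    fromℕ (2 ^ r) ℚ.* halfPow (d + r)                  ≤⟨ ℚₚ.*-monoʳ-≤-nonNeg (halfPow (d + r)) {{ℚ.nonNegative (halfPow-nonNeg (d + r))}} (fromℕ-mono-≤ (reach⇒score (suc d) rv r)) ⟩
    fromℕ (score (r + suc d) v) ℚ.* halfPow (d + r)    ≡⟨ cong (λ i → fromℕ (score i v) ℚ.* halfPow (d + r)) (trans (ℕₚ.+-suc r d) (cong suc (ℕₚ.+-comm r d))) ⟩
    fromℕ (score (suc (d + r)) v) ℚ.* halfPow (d + r)  ∎
    where open ℚₚ.≤-Reasoning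

  weight≤Score : ∀ {w} → IsWeight G S u w → w ℚ.≤ fromℕ (Score (suc K)) ℚ.* halfPow K
  weight≤Score (δ , dist , refl) = begin
    weightOf S δ                                                   ≡⟨ foldr-map-allFin ℚ._+_ 0ℚ summand ⟩
    ℚΣ.sum summand                                                 ≤⟨ ∑ℚ-mono-≤ summand≤ ⟩
    ℚΣ.sum (λ v → fromℕ (score (suc K) v) ℚ.* halfPow K)           ≡⟨ ∑ℚ-fromℕ-* (score (suc K)) (halfPow K) ⟩
    fromℕ (Score (suc K)) ℚ.* halfPow K                            ∎
    where
    open ℚₚ.≤-Reasoning
    summand : Fin (suc K) → ℚ
    summand v = if Vec.lookup S v then term (δ v) else 0ℚ
    summand≤ : ∀ v → summand v ℚ.≤ fromℕ (score (suc K) v) ℚ.* halfPow K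
    summand≤ v = by-membership (Vec.lookup S v) refl
      where
      by-membership : ∀ b → Vec.lookup S v ≡ b →
        (if b then term (δ v) else 0ℚ) ℚ.≤ fromℕ (score (suc K) v) ℚ.* halfPow K
      by-membership true  Sv = term≤score v (dist v (lookup⇒[]= v S Sv))
      by-membership false _  = fromℕ*halfPow-nonNeg (score (suc K) v) K

  -- fromℕ 3 and the + 3 ℚ./ 1 of theorem6 are the same normalised rational.
  weight≥3⇒saturated : ∀ {w} → IsWeight G S u w → fromℕ 3 ℚ.≤ w → 3 * 2 ^ K ≤ Score (suc K)
  weight≥3⇒saturated isWeight 3≤w = fromℕ-cancel-≤ (begin
    fromℕ (3 * 2 ^ K)                                        ≡⟨ fromℕ-* 3 (2 ^ K) ⟩
    fromℕ 3 ℚ.* fromℕ (2 ^ K)                                ≤⟨ ℚₚ.*-monoʳ-≤-nonNeg (fromℕ (2 ^ K)) {{ℚ.nonNegative (fromℕ-nonNeg (2 ^ K))}}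
                                                                  (ℚₚ.≤-trans 3≤w (weight≤Score isWeight)) ⟩
    fromℕ (Score (suc K)) ℚ.* halfPow K ℚ.* fromℕ (2 ^ K)    ≡⟨ ℚₚ.*-assoc (fromℕ (Score (suc K))) _ _ ⟩
    fromℕ (Score (suc K)) ℚ.* (halfPow K ℚ.* fromℕ (2 ^ K))  ≡⟨ cong (fromℕ (Score (suc K)) ℚ.*_) (halfPow-*-2^ K) ⟩
    fromℕ (Score (suc K)) ℚ.* 1ℚ                             ≡⟨ ℚₚ.*-identityʳ _ ⟩
    fromℕ (Score (suc K))                                    ∎)
    where open ℚₚ.≤-Reasoning

two-components-bound : ∀ {h c₁ c₂ s} → h ≡ c₁ + c₂ → 2 + c₁ ≤ s → 2 + c₂ ≤ s → h + 6 ≤ 3 * s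
two-components-bound {c₁ = c₁} {c₂} {s} refl p₁ p₂ = begin
  c₁ + c₂ + 6              ≡⟨ regroup c₁ c₂ ⟩
  (2 + c₁) + (2 + c₂) + 2  ≤⟨ ℕₚ.+-mono-≤ (ℕₚ.+-mono-≤ p₁ p₂) (ℕₚ.≤-trans (ℕₚ.m≤m+n 2 c₁) p₁) ⟩
  s + s + s                ≡⟨ triple s ⟩
  3 * s                    ∎
  where
  open ℕₚ.≤-Reasoning
  regroup : ∀ c₁ c₂ → c₁ + c₂ + 6 ≡ (2 + c₁) + (2 + c₂) + 2
  regroup = solve-∀
  triple : ∀ s → s + s + s ≡ 3 * s
  triple = solve-∀

module Components {K : ℕ} (G : Graph (suc K)) (S : VSet (suc K)) (deg≤3 : ∀ x → deg G x ≤ 3)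
  (saturated : ∀ u → T (not (S u)) → 3 * 2 ^ K ≤ Exploration.Score G S u (suc K)) where

  H : VSet (suc K)
  H x = not (S x)

  record Component (U : VSet (suc K)) : Set where
    field
      C           : VSet (suc K)
      C⊆U         : C ⊆ U
      nonempty    : 0 < count C
      S-large     : 2 + count C ≤ count S
      edges-large : 2 + count C ≤ edges G C S
      rest-closed : Closed G S (U ─ C)
      rest⊆H      : (U ─ C) ⊆ H

  open Component

  component : (U : VSet (suc K)) → Closed G S U → U ⊆ H → ∀ {u} → T (U u) → Component U
  component U U-closed U⊆H {u} Uu = record
    { C           = ball (suc K)
    ; C⊆U         = ball⊆closed U U-closed Uu (suc K)
    ; nonempty    = count-pos (ball (suc K)) (u∈ball K)
    ; S-large     = ℕₚ.≤-trans reach-large′ (count-mono (reach (suc K)) S (reach⊆S (suc K)))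
    ; edges-large = ℕₚ.≤-trans reach-large′ (reach≤edges u∉S deg≤3 K u-saturated)
    ; rest-closed = Closed-─ G S U (ball (suc K)) U-closed U⊆H (ball-closed u∉S deg≤3 K u-saturated)
    ; rest⊆H      = λ {x} → U⊆H ∘ proj₁ ∘ T-─⁻ U (ball (suc K)) {x}
    }
    where
    open Exploration G S u
    u∉S = U⊆H Uu
    u-saturated = saturated u u∉S
    reach-large′ = reach-large u∉S deg≤3 K u-saturated

  decompose : (U : VSet (suc K)) → Closed G S U → U ⊆ H → count U ≡ 0 ⊎ Component U
  decompose U U-closed U⊆H with any? (λ x → T? (U x))
  ... | no  U-empty  = inj₁ (count-empty U λ x Ux → U-empty (x , Ux))
  ... | yes (u , Uu) = inj₂ (component U U-closed U⊆H Uu)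

  module _ {U : VSet (suc K)} (P : Component U) where

    rest : VSet (suc K)
    rest = U ─ C P

    count-split : count U ≡ count (C P) + count rest
    count-split = sumOver-split U (C P) (λ _ → 1) (C⊆U P)

    edges-split : edges G U S ≡ edges G (C P) S + edges G rest S
    edges-split = sumOver-split U (C P) (λ x → count (adj G x ∩ S)) (C⊆U P)

    count-nonempty : 0 < count U
    count-nonempty = ℕₚ.<-≤-trans (nonempty P) (count-mono (C P) U (C⊆U P))

    rest-smaller : ∀ {m} → count U ≤ suc m → count rest ≤ m
    rest-smaller ≤sm = ℕₚ.≤-pred (ℕₚ.≤-trans (ℕₚ.+-monoˡ-≤ (count rest) (nonempty P))
                                   (ℕₚ.≤-trans (ℕₚ.≤-reflexive (sym count-split)) ≤sm))

  count≤edges : ∀ m U → count U ≤ m → Closed G S U → U ⊆ H → count U ≤ edges G U S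
  2+count≤edges : ∀ m {U} → Component U → count U ≤ m → 2 + count U ≤ edges G U S

  count≤edges m U ≤m U-closed U⊆H with decompose U U-closed U⊆H
  ... | inj₁ U≡0 = ℕₚ.≤-trans (ℕₚ.≤-reflexive U≡0) z≤n
  ... | inj₂ P   = ℕₚ.≤-trans (ℕₚ.m≤n+m (count U) 2) (2+count≤edges m P ≤m)

  2+count≤edges zero    P ≤0  = ⊥-elim (ℕₚ.<⇒≱ (count-nonempty P) ≤0)
  2+count≤edges (suc m) {U} P ≤sm = begin
    2 + count U                             ≡⟨ cong (2 +_) (count-split P) ⟩
    2 + (count (C P) + count (rest P))      ≡⟨ ℕₚ.+-assoc 2 (count (C P)) _ ⟨
    2 + count (C P) + count (rest P)        ≤⟨ ℕₚ.+-mono-≤ (edges-large P) rest-bound ⟩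
    edges G (C P) S + edges G (rest P) S    ≡⟨ edges-split P ⟨
    edges G U S                             ∎
    where
    open ℕₚ.≤-Reasoning
    rest-bound = count≤edges m (rest P) (rest-smaller P ≤sm) (rest-closed P) (rest⊆H P)

  H-closed : Closed G S H
  H-closed _ _ Hy = Hy

  H⊆H : H ⊆ H
  H⊆H p = p

  three-components-bound : (P₁ : Component H) (P₂ : Component (rest P₁)) → Component (rest P₂) →
    count H + 6 ≤ 3 * count S
  three-components-bound P₁ P₂ P₃ = begin
    count H + 6                                                ≡⟨ cong (_+ 6) H≡ ⟩
    count C₁ + (count C₂ + count R₂) + 6                       ≡⟨ regroup (count C₁) (count C₂) (count R₂) ⟩
    (2 + count C₁) + ((2 + count C₂) + (2 + count R₂))         ≤⟨ ℕₚ.+-mono-≤ (edges-large P₁) (ℕₚ.+-mono-≤ (edges-large P₂)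
                                                                    (2+count≤edges (suc K) P₃ (count≤n R₂))) ⟩
    edges G C₁ S + (edges G C₂ S + edges G R₂ S)               ≡⟨ edges≡ ⟨
    edges G H S                                                ≡⟨ edges-comm G H S ⟩
    edges G S H                                                ≤⟨ edges≤3count G deg≤3 S H ⟩
    3 * count S                                                ∎
    where
    open ℕₚ.≤-Reasoning
    C₁ = C P₁
    C₂ = C P₂
    R₂ = rest P₂
    H≡ : count H ≡ count C₁ + (count C₂ + count R₂)
    H≡ = trans (count-split P₁) (cong (count C₁ +_) (count-split P₂))
    edges≡ : edges G H S ≡ edges G C₁ S + (edges G C₂ S + edges G R₂ S)
    edges≡ = trans (edges-split P₁) (cong (edges G C₁ S +_) (edges-split P₂))
    regroup : ∀ c₁ c₂ r → c₁ + (c₂ + r) + 6 ≡ (2 + c₁) + ((2 + c₂) + (2 + r))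
    regroup = solve-∀

  H-bound : 3 ≤ suc K → count H + 6 ≤ 3 * count S
  H-bound 3≤n with decompose H H-closed H⊆H
  ... | inj₁ H≡0 = two-components-bound {c₁ = 0} {c₂ = 0} H≡0 2≤S 2≤S
    where
    2≤S : 2 ≤ count S
    2≤S = ℕₚ.≤-trans (ℕₚ.n≤1+n 2) (ℕₚ.≤-trans 3≤n (ℕₚ.≤-reflexive
            (trans (sym (count-not+count S)) (cong (_+ count S) H≡0))))
  ... | inj₂ P₁ with decompose (rest P₁) (rest-closed P₁) (rest⊆H P₁)
  ...   | inj₁ R₁≡0 = two-components-bound (trans (count-split P₁) (cong (count (C P₁) +_) R₁≡0))
                        (S-large P₁) (ℕₚ.≤-trans (ℕₚ.m≤m+n 2 _) (S-large P₁))
  ...   | inj₂ P₂ with decompose (rest P₂) (rest-closed P₂) (rest⊆H P₂)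
  ...     | inj₁ R₂≡0 = two-components-bound
                          (trans (count-split P₁) (cong (count (C P₁) +_) (trans (count-split P₂) (cong (count (C P₂) +_) R₂≡0))))
                          (S-large P₁) (ℕₚ.≤-trans (ℕₚ.≤-reflexive (cong (2 +_) (ℕₚ.+-identityʳ _))) (S-large P₂))
  ...     | inj₂ P₃ = three-components-bound P₁ P₂ P₃

open import Data.Integer using (+_)

theorem6 : (n : ℕ) → 3 ≤ n → (G : Graph n) → (∀ u → degree G u ≤ 3) →
    (S : Subset n) →
    (∀ u → u ∉ S → Σ ℚ (λ w → IsWeight G S u w × ((+ 3 ℚ./ 1) ℚ.≤ w))) →
    n + 6 ≤ 4 * ∣ S ∣
theorem6 (suc K) 3≤n G degree≤3 S weight≥3 = begin
  suc K + 6                  ≡⟨ cong (_+ 6) (count-not+count S′) ⟨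
  count H + count S′ + 6     ≡⟨ shuffle (count H) (count S′) ⟩
  count H + 6 + count S′     ≤⟨ ℕₚ.+-monoˡ-≤ (count S′) (H-bound 3≤n) ⟩
  3 * count S′ + count S′    ≡⟨ quadruple (count S′) ⟩
  4 * count S′               ≡⟨ cong (4 *_) (∣S∣≡count S) ⟨
  4 * ∣ S ∣                  ∎
  where
  open ℕₚ.≤-Reasoning
  S′ : VSet (suc K)
  S′ = Vec.lookup S
  deg≤3 : ∀ x → deg G x ≤ 3
  deg≤3 x = subst (_≤ 3) (degree≡deg G x) (degree≤3 x)
  saturated : ∀ u → T (not (S′ u)) → 3 * 2 ^ K ≤ Exploration.Score G S′ u (suc K)
  saturated u u∉S = let (w , isWeight , 3≤w) = weight≥3 u (T-not⇒∉ S u∉S)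
                    in Distances.weight≥3⇒saturated G S u (T-not⇒∉ S u∉S) isWeight 3≤w
  open Components G S′ deg≤3 saturated
  shuffle : ∀ h s → h + s + 6 ≡ h + 6 + s
  shuffle = solve-∀
  quadruple : ∀ s → 3 * s + s ≡ 4 * s
  quadruple = solve-∀
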